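{- For all integers $h\geq 0$, $d\geq 1$ and every leaf $\ell^h_j$ of $\mathcal{T}^h$, let $d'=\mathrm{dist}_{\mathcal{T}^h\setminus F^h_j}(rt(\mathcal{T}^h),\ell^h_j)$. Then $d'$ is finite, $\ell^h_j$ is the leaf at minimum finite distance from $rt(\mathcal{T}^h)$ in $\mathcal{T}^h\setminus F^h_j$, and every other leaf in $L(\mathcal{T}^h)\setminus\{\ell^h_j\}$ is at distance at least $d'+2$ from $rt(\mathcal{T}^h)$ in $\mathcal{T}^h\setminus F^h_j$.
   Context: The undirected unweighted rooted tree $\mathcal{T}^h$ with size parameter $d$ is defined recursively. $\mathcal{T}^0$ is a single node, its root, which is also its unique leaf. For $h\geq 1$, take $d$ disjoint copies $\mathcal{T}^{h-1}_0,\ldots,\mathcal{T}^{h-1}_{d-1}$ of $\mathcal{T}^{h-1}$, add a new path $v_0,\ldots,v_{d-1}$, set $rt(\mathcal{T}^h)=v_0$, and for each $j$ connect $v_j$ to $rt(\mathcal{T}^{h-1}_j)$ by a path with new internal nodes of length $(d-j)(\ell(h-1)+3)$, where $\ell(h-1)$ is the height of $\mathcal{T}^{h-1}$ (maximum distance from its root to a node). The leaf set $L(\mathcal{T}^h)$ is the union of the leaf sets of the copies $\mathcal{T}^{h-1}_j$; it has $d^h$ elements. The leaves are ordered left to right recursively: all leaves of $\mathcal{T}^{h-1}_j$ precede those of $\mathcal{T}^{h-1}_{j+1}$, and within each copy the order is the recursive one; they are named $\ell^h_0,\ldots,\ell^h_{d^h-1}$ in this order. Edge sets $F^h_j$ are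 defined recursively: $F^0_0=\emptyset$; for $h\geq1$, if $\ell^h_j$ is the $r$-th leaf (zero-based) of the copy $\mathcal{T}^{h-1}_t$, then $F^h_j$ consists of the edges of the copy of $F^{h-1}_r$ inside $\mathcal{T}^{h-1}_t$, together with the edge $(v_t,v_{t+1})$ if $t<d-1$. Thus $|F^h_j|\leq h$. Distances to nodes disconnected from the root are infinite. -}

module Defs where

open import Data.Nat using (ℕ; zero; suc; _+_; _*_; _∸_; _⊔_; _≤_; _<_; _<?_)
open import Data.Fin using (Fin; toℕ; fromℕ<)
import Data.Fin as F
open import Data.Vec using (Vec; []; _∷_)
open import Data.Product using (Σ; _×_; _,_; proj₁; proj₂)
open import Data.Sum using (_⊎_)
open import Relation.Nullary using (¬_; yes; no)
open import Relation.Binary.PropositionalEquality using (_≡_)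

maxF : ∀ {n} → (Fin n → ℕ) → ℕ
maxF {zero}  f = 0
maxF {suc n} f = f F.zero ⊔ maxF (λ i → f (F.suc i))

module Tree (d : ℕ) (d>0 : 0 < d) where

  mutual
    -- ℓ(h): height of 𝒯^h, i.e. the maximum depth of a node.
    -- Depth of v_j is j, of the internal path nodes below v_j at most j + len,
    -- of a node of copy j is j + len h j + (its depth inside the copy).
    height : ℕ → ℕ
    height zero    = 0
    height (suc h) = (d ∸ 1) ⊔ maxF (λ j → toℕ j + len h j + height h)

    -- length of the path joining v_j to the root of the copy 𝒯^h_j in 𝒯^(h+1)
    len : ℕ → Fin d → ℕ
    len h j = (d ∸ toℕ j) * (height h + 3)

  data Node : ℕ → Set where
    ρ₀    : Node zero
    spine : ∀ {h} → Fin d → Node (suc h)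
    inner : ∀ {h} (j : Fin d) → Fin (len h j ∸ 1) → Node (suc h) -- internal node at distance k+1 from v_j on its path
    sub   : ∀ {h} → Fin d → Node h → Node (suc h)

  root : ∀ h → Node h
  root zero    = ρ₀
  root (suc h) = spine (fromℕ< d>0)

  -- node at position i on the path v_j = pos 0, …, pos (len h j) = rt(𝒯^h_j)
  pos : ∀ {h} (j : Fin d) → ℕ → Node (suc h)
  pos j zero = spine j
  pos {h} j (suc k) with k <? (len h j ∸ 1)
  ... | yes p = inner j (fromℕ< p)
  ... | no  _ = sub j (root h)

  data Edge : ℕ → Set where
    spineE : ∀ {h} (t : Fin d) → suc (toℕ t) < d → Edge (suc h)
    pathE  : ∀ {h} (j : Fin d) → Fin (len h j) → Edge (suc h)
    subE   : ∀ {h} → Fin d → Edge h → Edge (suc h)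

  ends : ∀ {h} → Edge h → Node h × Node h
  ends (spineE t p) = spine t , spine (fromℕ< p)
  ends (pathE j i)  = pos j (toℕ i) , pos j (suc (toℕ i))
  ends (subE j e)   = sub j (proj₁ (ends e)) , sub j (proj₂ (ends e))

  -- Leaves are addressed by their path of copy indices; the left-to-right
  -- order of the paper is the lexicographic order of these addresses.
  LeafAddr : ℕ → Set
  LeafAddr h = Vec (Fin d) h

  leaf : ∀ {h} → LeafAddr h → Node h
  leaf []      = ρ₀
  leaf (t ∷ r) = sub t (leaf r)

  data InF : ∀ {h} → LeafAddr h → Edge h → Set where
    top : ∀ {h} {t : Fin d} {r : LeafAddr h} (p : suc (toℕ t) < d) →
          InF (t ∷ r) (spineE t p)
    rec : ∀ {h} {t : Fin d} {r : LeafAddr h} {e : Edge h} →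
          InF r e → InF (t ∷ r) (subE t e)

  Adj : ∀ {h} → LeafAddr h → Node h → Node h → Set
  Adj {h} a u v = Σ (Edge h) λ e → ¬ InF a e × (ends e ≡ (u , v) ⊎ ends e ≡ (v , u))

  data Walk {h} (a : LeafAddr h) : Node h → Node h → ℕ → Set where
    nil  : ∀ {u} → Walk a u u 0
    cons : ∀ {u v w k} → Adj a u v → Walk a v w k → Walk a u w (suc k)

  IsDist : ∀ {h} → LeafAddr h → Node h → Node h → ℕ → Set
  IsDist a u v k = Walk a u v k × (∀ m → Walk a u v m → k ≤ m)

-- A potential φₐ on the nodes of 𝒯ʰ ∖ Fₐ certifies the distances: φₐ changes by at most one
-- along every surviving edge and vanishes at the root, so no walk from the root to v is shorter
-- than φₐ(v). Outside the copy containing the leaf a, φₐ is the depth, plus a penalty on the spine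
-- vertices behind the removed spine edge (they are cut off from the root anyway); inside that copy
-- it is defined recursively. The path to a realises φₐ(a) = depth(a). A leaf in a later copy pays
-- the penalty; a leaf in an earlier copy s < t lies below a path longer by (t − s)(ℓ(h−1) + 3), more
-- than the whole copy t plus two; a leaf in the same copy is handled by induction.
module Submission where

open import Defs
open import Data.Nat using (ℕ; zero; suc; _+_; _∸_; _*_; _≤_; _<_; z≤n; s≤s; _≤?_; _<?_; >-nonZero)
open import Data.Nat.Properties
open import Data.Nat.Tactic.RingSolver using (solve-∀)
open import Data.Fin as F using (Fin; toℕ; fromℕ<)
open import Data.Fin.Properties using (toℕ-injective; toℕ<n; fromℕ<-toℕ; toℕ-fromℕ<; fromℕ<-cong)
open import Data.Vec using ([]; _∷_)
open import Data.Vec.Properties using (≡-dec)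
import Data.Product as Product
open import Data.Product using (Σ; _×_; _,_; proj₁; proj₂)
import Data.Sum as Sum
open import Data.Sum using (inj₁; inj₂)
open import Data.Empty using (⊥-elim)
open import Relation.Binary.Definitions using (tri<; tri≈; tri>)
open import Relation.Nullary using (yes; no; ¬_)
open import Relation.Binary.PropositionalEquality
  using (_≡_; _≢_; refl; sym; trans; cong; cong₂; subst; subst₂)

infix 4 _≈₁_

_≈₁_ : ℕ → ℕ → Set
x ≈₁ y = x ≤ suc y × y ≤ suc x

n≈₁1+n : ∀ n → n ≈₁ suc n
n≈₁1+n n = m≤n+m n 2 , ≤-refl

+-preserves-≈₁ : ∀ c {x y} → x ≈₁ y → c + x ≈₁ c + y
+-preserves-≈₁ c {x} {y} (x≤1+y , y≤1+x) =
  subst (c + x ≤_) (+-suc c y) (+-monoʳ-≤ c x≤1+y) ,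
  subst (c + y ≤_) (+-suc c x) (+-monoʳ-≤ c y≤1+x)

maxF-upper : ∀ {n} (f : Fin n → ℕ) (i : Fin n) → f i ≤ maxF f
maxF-upper f F.zero    = m≤m⊔n _ _
maxF-upper f (F.suc i) = ≤-trans (maxF-upper (λ i → f (F.suc i)) i) (m≤n⊔m _ _)

spine-offset : ℕ → ℕ → ℕ → ℕ
spine-offset K t n with n ≤? t
... | yes _ = n
... | no  _ = n + K

spine-offset-≤ : ∀ {K t n} → n ≤ t → spine-offset K t n ≡ n
spine-offset-≤ {K} {t} {n} n≤t with n ≤? t
... | yes _   = refl
... | no  n≰t = ⊥-elim (n≰t n≤t)

spine-offset-> : ∀ {K t n} → t < n → K ≤ spine-offset K t n
spine-offset-> {K} {t} {n} t<n with n ≤? t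
... | yes n≤t = ⊥-elim (<⇒≱ t<n n≤t)
... | no  _   = m≤n+m K n

spine-offset-step : ∀ K t n → n ≢ t → spine-offset K t n ≈₁ spine-offset K t (suc n)
spine-offset-step K t n n≢t with n ≤? t | suc n ≤? t
... | yes _   | yes _     = n≈₁1+n n
... | yes n≤t | no  n≮t   = ⊥-elim (n≮t (≤∧≢⇒< n≤t n≢t))
... | no  n≰t | yes 1+n≤t = ⊥-elim (n≰t (<⇒≤ 1+n≤t))
... | no  _   | no  _     = n≈₁1+n (n + K)

*-gap : ∀ t w c → suc t + w * (c + 3) + c + 2 ≤ (suc t + w) * (c + 3)
*-gap t w c = begin
  suc t + w * (c + 3) + c + 2      ≡⟨ regroupˡ t w c ⟩
  t + (c + 3 + w * (c + 3))        ≤⟨ +-monoˡ-≤ _ (m≤m*n t (c + 3) ⦃ >-nonZero c+3>0 ⦄) ⟩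
  t * (c + 3) + (c + 3 + w * (c + 3)) ≡⟨ regroupʳ t w c ⟩
  (suc t + w) * (c + 3)            ∎
  where
  open ≤-Reasoning
  regroupˡ : ∀ t w c → suc t + w * (c + 3) + c + 2 ≡ t + (c + 3 + w * (c + 3))
  regroupˡ = solve-∀
  regroupʳ : ∀ t w c → t * (c + 3) + (c + 3 + w * (c + 3)) ≡ (suc t + w) * (c + 3)
  regroupʳ = solve-∀
  c+3>0 : 0 < c + 3
  c+3>0 = ≤-trans (s≤s z≤n) (m≤n+m 3 c)

∸-gap : ∀ d s t c → s < t → t ≤ d → t + (d ∸ t) * (c + 3) + c + 2 ≤ s + (d ∸ s) * (c + 3)
∸-gap (suc d) (suc s) (suc t) c (s≤s s<t) (s≤s t≤d) = s≤s (∸-gap d s t c s<t t≤d)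
∸-gap d zero (suc t) c _ t≤d = begin
  suc t + (d ∸ suc t) * (c + 3) + c + 2 ≤⟨ *-gap t (d ∸ suc t) c ⟩
  (suc t + (d ∸ suc t)) * (c + 3)     ≡⟨ cong (_* (c + 3)) (m+[n∸m]≡n t≤d) ⟩
  d * (c + 3)                         ∎
  where open ≤-Reasoning

module TreeProperties (d : ℕ) (d>0 : 0 < d) where
  open Tree d d>0

  depth : ∀ {h} → Node h → ℕ
  depth ρ₀                = 0
  depth (spine s)         = toℕ s
  depth (inner s k)       = toℕ s + suc (toℕ k)
  depth {suc h} (sub s n) = toℕ s + len h s + depth n

  depth-root : ∀ h → depth (root h) ≡ 0
  depth-root zero    = refl
  depth-root (suc h) = toℕ-fromℕ< d>0

  depth-leaf≤height : ∀ {h} (a : LeafAddr h) → depth (leaf a) ≤ height h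
  depth-leaf≤height []              = z≤n
  depth-leaf≤height {suc h} (s ∷ r) = begin
    toℕ s + len h s + depth (leaf r) ≤⟨ +-monoʳ-≤ (toℕ s + len h s) (depth-leaf≤height r) ⟩
    toℕ s + len h s + height h       ≤⟨ maxF-upper (λ j → toℕ j + len h j + height h) s ⟩
    maxF (λ j → toℕ j + len h j + height h) ≤⟨ m≤n⊔m (d ∸ 1) _ ⟩
    height (suc h)                   ∎
    where open ≤-Reasoning

  copy-gap : ∀ h {s t : Fin d} → toℕ s < toℕ t → toℕ t + len h t + height h + 2 ≤ toℕ s + len h s
  copy-gap h {s} {t} s<t = ∸-gap d (toℕ s) (toℕ t) (height h) s<t (<⇒≤ (toℕ<n t))

  len-positive : ∀ h (t : Fin d) → 0 < len h t
  len-positive h t = *-mono-≤ (m<n⇒0<n∸m (toℕ<n t)) (≤-trans (s≤s z≤n) (m≤n+m 3 (height h)))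

  pos-end : ∀ {h} (t : Fin d) → pos {h} t (len h t) ≡ sub t (root h)
  pos-end {h} t = last (len h t) refl (len-positive h t)
    where
    last : ∀ n → n ≡ len h t → 0 < n → pos t n ≡ sub t (root h)
    last (suc k) 1+k≡len _ with k <? len h t ∸ 1
    ... | yes k<len-1 = ⊥-elim (<-irrefl (cong (_∸ 1) 1+k≡len) k<len-1)
    ... | no  _       = refl

  record AffineOnPath {h} (s : Fin d) (f : Node (suc h) → ℕ) (c : ℕ) : Set where
    field
      at-spine : f (spine s) ≡ c
      at-inner : ∀ k (k<len-1 : k < len h s ∸ 1) → f (inner s (fromℕ< k<len-1)) ≡ c + suc k
      at-copy  : f (sub s (root h)) ≡ c + len h s

  pos-affine : ∀ {h} {s : Fin d} {f : Node (suc h) → ℕ} {c : ℕ} → AffineOnPath s f c →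
               ∀ i → i ≤ len h s → f (pos s i) ≡ c + i
  pos-affine {c = c} affine zero _ = trans (AffineOnPath.at-spine affine) (sym (+-identityʳ c))
  pos-affine {h} {s} {c = c} affine (suc k) 1+k≤len with k <? len h s ∸ 1
  ... | yes k<len-1 = AffineOnPath.at-inner affine k k<len-1
  ... | no  k≮len-1 = trans (AffineOnPath.at-copy affine) (cong (c +_) (≤-antisym len≤1+k 1+k≤len))
    where
    len≤1+k : len h s ≤ suc k
    len≤1+k = ≤-trans (m≤n+m∸n (len h s) 1) (s≤s (≮⇒≥ k≮len-1))

  path-edge-≈₁ : ∀ {h} {s : Fin d} {f : Node (suc h) → ℕ} {c : ℕ} → AffineOnPath s f c →
                 (i : Fin (len h s)) → f (pos s (toℕ i)) ≈₁ f (pos s (suc (toℕ i)))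
  path-edge-≈₁ {c = c} affine i =
    subst₂ _≈₁_ (sym (pos-affine affine (toℕ i) (<⇒≤ (toℕ<n i))))
                (sym (pos-affine affine (suc (toℕ i)) (toℕ<n i)))
                (+-preserves-≈₁ c (n≈₁1+n (toℕ i)))

  depth-affine : ∀ {h} (s : Fin d) → AffineOnPath {h} s depth (toℕ s)
  depth-affine {h} s = record
    { at-spine = refl
    ; at-inner = λ k k<len-1 → cong (λ i → toℕ s + suc i) (toℕ-fromℕ< k<len-1)
    ; at-copy  = trans (cong (toℕ s + len h s +_) (depth-root h)) (+-identityʳ _)
    }

  depth-step : ∀ {h} (e : Edge h) → depth (proj₁ (ends e)) ≈₁ depth (proj₂ (ends e))
  depth-step (spineE s 1+s<d)   = subst (toℕ s ≈₁_) (sym (toℕ-fromℕ< 1+s<d)) (n≈₁1+n (toℕ s))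
  depth-step (pathE s i)        = path-edge-≈₁ (depth-affine s) i
  depth-step {suc h} (subE s e) = +-preserves-≈₁ (toℕ s + len h s) (depth-step e)

  OneLipschitz : ∀ {h} → LeafAddr h → (Node h → ℕ) → Set
  OneLipschitz {h} a f = ∀ (e : Edge h) → ¬ InF a e → f (proj₁ (ends e)) ≈₁ f (proj₂ (ends e))

  adj-step : ∀ {h} {a : LeafAddr h} {f : Node h → ℕ} → OneLipschitz a f →
    ∀ {u v} → Adj a u v → f v ≤ suc (f u)
  adj-step lipschitz (e , e∉F , inj₁ refl) = proj₂ (lipschitz e e∉F)
  adj-step lipschitz (e , e∉F , inj₂ refl) = proj₁ (lipschitz e e∉F)

  walk-potential-bound : ∀ {h} {a : LeafAddr h} {f : Node h → ℕ} → OneLipschitz a f →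
    ∀ {u v m} → Walk a u v m → f v ≤ f u + m
  walk-potential-bound {f = f} lipschitz {u} nil = m≤m+n (f u) 0
  walk-potential-bound {f = f} lipschitz {u} (cons {v = v} {w} {k} u~v walk) = begin
    f w           ≤⟨ walk-potential-bound lipschitz walk ⟩
    f v + k       ≤⟨ +-monoˡ-≤ k (adj-step lipschitz u~v) ⟩
    suc (f u) + k ≡⟨ sym (+-suc (f u) k) ⟩
    f u + suc k   ∎
    where open ≤-Reasoning

  _▷_ : ∀ {h} {a : LeafAddr h} {u v w m} → Walk a u v m → Adj a v w → Walk a u w (suc m)
  nil         ▷ v~w = cons v~w nil
  cons u~x xv ▷ v~w = cons u~x (xv ▷ v~w)

  _++ʷ_ : ∀ {h} {a : LeafAddr h} {u v w m n} → Walk a u v m → Walk a v w n → Walk a u w (m + n)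
  nil         ++ʷ vw = vw
  cons u~x xv ++ʷ vw = cons u~x (xv ++ʷ vw)

  adj-in-copy : ∀ {h} {t : Fin d} {r : LeafAddr h} {x y} → Adj r x y → Adj (t ∷ r) (sub t x) (sub t y)
  adj-in-copy {t = t} (e , e∉F , x~y) =
    subE t e , (λ { (rec e∈F) → e∉F e∈F }) ,
    Sum.map (cong (Product.map (sub t) (sub t))) (cong (Product.map (sub t) (sub t))) x~y

  walk-in-copy : ∀ {h} {t : Fin d} {r : LeafAddr h} {x y m} → Walk r x y m → Walk (t ∷ r) (sub t x) (sub t y) m
  walk-in-copy nil           = nil
  walk-in-copy (cons x~z zy) = cons (adj-in-copy x~z) (walk-in-copy zy)

  spine-kept : ∀ {h} {t : Fin d} {r : LeafAddr h} {s q} → toℕ s ≢ toℕ t → ¬ InF (t ∷ r) (spineE s q)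
  spine-kept s≢t (top _) = s≢t refl

  spine-removed : ∀ {h} {t : Fin d} {r : LeafAddr h} {s} q → ¬ InF (t ∷ r) (spineE s q) → toℕ s ≢ toℕ t
  spine-removed q s∉F s≡t with toℕ-injective s≡t
  ... | refl = s∉F (top q)

  -- Spine vertices past t cannot be reached from the root, so any penalty ≥ depth(leaf a) + 2 works.
  spine-potential : ∀ {h} → LeafAddr (suc h) → Fin d → ℕ
  spine-potential (t ∷ r) s = spine-offset (depth (leaf (t ∷ r)) + 2) (toℕ t) (toℕ s)

  mutual
    potential : ∀ {h} → LeafAddr h → Node h → ℕ
    potential [] ρ₀                     = 0
    potential a (spine s)               = spine-potential a s
    potential a (inner s k)             = spine-potential a s + suc (toℕ k)
    potential {suc h} (t ∷ r) (sub s n) = spine-potential (t ∷ r) s + len h s + potential-in-copy r t s n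

    potential-in-copy : ∀ {h} → LeafAddr h → Fin d → Fin d → Node h → ℕ
    potential-in-copy r t s n with s F.≟ t
    ... | yes _ = potential r n
    ... | no  _ = depth n

  potential-root : ∀ {h} (a : LeafAddr h) → potential a (root h) ≡ 0
  potential-root []      = refl
  potential-root (t ∷ r) = trans (cong (spine-offset K (toℕ t)) (toℕ-fromℕ< d>0)) (spine-offset-≤ {K} {toℕ t} z≤n)
    where K = depth (leaf (t ∷ r)) + 2

  potential-in-copy-root : ∀ {h} (r : LeafAddr h) (t s : Fin d) → potential-in-copy r t s (root h) ≡ 0
  potential-in-copy-root {h} r t s with s F.≟ t
  ... | yes _ = potential-root r
  ... | no  _ = depth-root h

  potential-in-own-copy : ∀ {h} (r : LeafAddr h) (t : Fin d) n → potential-in-copy r t t n ≡ potential r n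
  potential-in-own-copy r t n with t F.≟ t
  ... | yes _   = refl
  ... | no  t≢t = ⊥-elim (t≢t refl)

  potential-affine : ∀ {h} (t : Fin d) (r : LeafAddr h) (s : Fin d) →
    AffineOnPath s (potential (t ∷ r)) (spine-potential (t ∷ r) s)
  potential-affine {h} t r s = record
    { at-spine = refl
    ; at-inner = λ k k<len-1 → cong (λ i → c + suc i) (toℕ-fromℕ< k<len-1)
    ; at-copy  = trans (cong (c + len h s +_) (potential-in-copy-root r t s)) (+-identityʳ _)
    }
    where c = spine-potential (t ∷ r) s

  mutual
    potential-step : ∀ {h} (a : LeafAddr h) → OneLipschitz a (potential a)
    potential-step [] () _
    potential-step (t ∷ r) (spineE s 1+s<d) e∉F =
      subst (λ n → spine-offset K (toℕ t) (toℕ s) ≈₁ spine-offset K (toℕ t) n)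
            (sym (toℕ-fromℕ< 1+s<d))
            (spine-offset-step K (toℕ t) (toℕ s) (spine-removed 1+s<d e∉F))
      where K = depth (leaf (t ∷ r)) + 2
    potential-step (t ∷ r) (pathE s i) _ = path-edge-≈₁ (potential-affine t r s) i
    potential-step {suc h} (t ∷ r) (subE s e) e∉F =
      +-preserves-≈₁ (spine-potential (t ∷ r) s + len h s)
                     (potential-in-copy-step r t s e e∉F)

    potential-in-copy-step : ∀ {h} (r : LeafAddr h) (t s : Fin d) (e : Edge h) → ¬ InF (t ∷ r) (subE s e) →
      potential-in-copy r t s (proj₁ (ends e)) ≈₁ potential-in-copy r t s (proj₂ (ends e))
    potential-in-copy-step r t s e e∉F with s F.≟ t
    ... | yes refl = potential-step r e (λ e∈F → e∉F (rec e∈F))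
    ... | no  _    = depth-step e

  potential-own-copy-leaf : ∀ {h} (t : Fin d) (r r′ : LeafAddr h) →
    potential (t ∷ r) (leaf (t ∷ r′)) ≡ toℕ t + len h t + potential r (leaf r′)
  potential-own-copy-leaf {h} t r r′ =
    cong₂ (λ o p → o + len h t + p) (spine-offset-≤ ≤-refl) (potential-in-own-copy r t (leaf r′))

  potential-own-leaf : ∀ {h} (a : LeafAddr h) → potential a (leaf a) ≡ depth (leaf a)
  potential-own-leaf []              = refl
  potential-own-leaf {suc h} (t ∷ r) =
    trans (potential-own-copy-leaf t r r) (cong (toℕ t + len h t +_) (potential-own-leaf r))

  potential-other-leaf : ∀ {h} (a i : LeafAddr h) → i ≢ a → depth (leaf a) + 2 ≤ potential a (leaf i)
  potential-other-leaf [] [] []≢[] = ⊥-elim ([]≢[] refl)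
  potential-other-leaf {suc h} (t ∷ r) (s ∷ r′) i≢a with <-cmp (toℕ s) (toℕ t)
  ... | tri< s<t _ _ = begin
    toℕ t + len h t + depth (leaf r) + 2 ≤⟨ +-monoˡ-≤ 2 (+-monoʳ-≤ (toℕ t + len h t) (depth-leaf≤height r)) ⟩
    toℕ t + len h t + height h + 2       ≤⟨ copy-gap h s<t ⟩
    toℕ s + len h s                      ≡⟨ cong (_+ len h s) (sym (spine-offset-≤ (<⇒≤ s<t))) ⟩
    spine-potential (t ∷ r) s + len h s  ≤⟨ m≤m+n _ _ ⟩
    potential (t ∷ r) (leaf (s ∷ r′))    ∎
    where open ≤-Reasoning
  ... | tri> _ _ t<s =
    ≤-trans (spine-offset-> t<s) (≤-trans (m≤m+n _ _) (m≤m+n _ _))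
  ... | tri≈ _ s≡t _ with toℕ-injective s≡t
  ... | refl = begin
    toℕ t + len h t + depth (leaf r) + 2    ≡⟨ +-assoc (toℕ t + len h t) (depth (leaf r)) 2 ⟩
    toℕ t + len h t + (depth (leaf r) + 2)  ≤⟨ +-monoʳ-≤ (toℕ t + len h t) (potential-other-leaf r r′ r′≢r) ⟩
    toℕ t + len h t + potential r (leaf r′) ≡⟨ sym (potential-own-copy-leaf t r r′) ⟩
    potential (t ∷ r) (leaf (t ∷ r′))       ∎
    where
    open ≤-Reasoning
    r′≢r : r′ ≢ r
    r′≢r r′≡r = i≢a (cong (t ∷_) r′≡r)

  potential≤walk : ∀ {h} (a : LeafAddr h) {v m} → Walk a (root h) v m → potential a v ≤ m
  potential≤walk {h} a {v} {m} walk =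
    subst (λ p → potential a v ≤ p + m) (potential-root a) (walk-potential-bound (potential-step a) walk)

  spine-walk : ∀ {h} (t : Fin d) (r : LeafAddr h) n (n<d : n < d) → n ≤ toℕ t →
               Walk (t ∷ r) (root (suc h)) (spine (fromℕ< n<d)) n
  spine-walk t r zero 0<d _ =
    subst (λ z → Walk (t ∷ r) (root _) (spine z) 0) (fromℕ<-cong 0 0 refl d>0 0<d) nil
  spine-walk t r (suc n) 1+n<d 1+n≤t = spine-walk t r n n<d (<⇒≤ 1+n≤t) ▷ step
    where
    n<d : n < d
    n<d = <⇒≤ 1+n<d
    kept : suc (toℕ (fromℕ< n<d)) < d
    kept = subst (λ x → suc x < d) (sym (toℕ-fromℕ< n<d)) 1+n<d
    step : Adj (t ∷ r) (spine (fromℕ< n<d)) (spine (fromℕ< 1+n<d))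
    step = spineE (fromℕ< n<d) kept ,
           spine-kept (λ n≡t → <-irrefl (trans (sym (toℕ-fromℕ< n<d)) n≡t) 1+n≤t) ,
           inj₁ (cong (λ x → spine (fromℕ< n<d) , spine x)
                      (fromℕ<-cong _ _ (cong suc (toℕ-fromℕ< n<d)) kept 1+n<d))

  path-walk : ∀ {h} (t : Fin d) (r : LeafAddr h) k → k ≤ len h t → Walk (t ∷ r) (spine t) (pos t k) k
  path-walk t r zero    _       = nil
  path-walk t r (suc k) 1+k≤len =
    path-walk t r k (<⇒≤ 1+k≤len) ▷
    (pathE t (fromℕ< 1+k≤len) , (λ ()) , inj₁ (cong (λ x → pos t x , pos t (suc x)) (toℕ-fromℕ< 1+k≤len)))

  walk-to-leaf : ∀ {h} (a : LeafAddr h) → Walk a (root h) (leaf a) (depth (leaf a))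
  walk-to-leaf []              = nil
  walk-to-leaf {suc h} (t ∷ r) =
    subst (Walk (t ∷ r) (root (suc h)) (leaf (t ∷ r))) (sym (+-assoc (toℕ t) (len h t) (depth (leaf r))))
      (to-spine ++ʷ (down-path ++ʷ walk-in-copy (walk-to-leaf r)))
    where
    to-spine : Walk (t ∷ r) (root (suc h)) (spine t) (toℕ t)
    to-spine = subst (λ x → Walk (t ∷ r) (root (suc h)) (spine x) (toℕ t)) (fromℕ<-toℕ t (toℕ<n t))
                     (spine-walk t r (toℕ t) (toℕ<n t) ≤-refl)
    down-path : Walk (t ∷ r) (spine t) (sub t (root h)) (len h t)
    down-path = subst (λ x → Walk (t ∷ r) (spine t) x (len h t)) (pos-end t) (path-walk t r (len h t) ≤-refl)

  other-leaves-far : ∀ {h} (a i : LeafAddr h) → i ≢ a → ∀ {m} → Walk a (root h) (leaf i) m → depth (leaf a) + 2 ≤ m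
  other-leaves-far a i i≢a walk = ≤-trans (potential-other-leaf a i i≢a) (potential≤walk a walk)

  own-leaf-nearest : ∀ {h} (a i : LeafAddr h) {m} → Walk a (root h) (leaf i) m → depth (leaf a) ≤ m
  own-leaf-nearest a i {m} walk with ≡-dec F._≟_ i a
  ... | yes refl = subst (_≤ m) (potential-own-leaf a) (potential≤walk a walk)
  ... | no  i≢a  = ≤-trans (m≤m+n _ 2) (other-leaves-far a i i≢a walk)

lemma11 : (d : ℕ) (d>0 : 0 < d) (h : ℕ) (j : Tree.LeafAddr d d>0 h) →
    Σ ℕ λ d′ →
    Tree.IsDist d d>0 j (Tree.root d d>0 h) (Tree.leaf d d>0 j) d′
    × (∀ (i : Tree.LeafAddr d d>0 h) (m : ℕ) →
    Tree.Walk d d>0 j (Tree.root d d>0 h) (Tree.leaf d d>0 i) m → d′ ≤ m)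
    × (∀ (i : Tree.LeafAddr d d>0 h) → i ≢ j → (m : ℕ) →
    Tree.Walk d d>0 j (Tree.root d d>0 h) (Tree.leaf d d>0 i) m → d′ + 2 ≤ m)
lemma11 d d>0 h j =
  depth (leaf j) ,
  (walk-to-leaf j , λ m → own-leaf-nearest j j) ,
  (λ i m → own-leaf-nearest j i) ,
  (λ i i≢j m → other-leaves-far j i i≢j)
  where
  open Tree d d>0
  open TreeProperties d d>0
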